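{- For every non-empty $B\subset\mathbb{N}$, there exists a non-self-loop function $S$ (from $\mathbb{N}^k$ to $\mathbb{Z}$ for some $k\ge1$) such that $\langle B,S\rangle$ is an $\mathbb{N}$-Induction Model.
   Context: $\mathbb{N}=\{1,2,\dots\}$. $S:\mathbb{N}^k\to\mathbb{Z}$ is a self-loop function if $S(x_1,\dots,x_k)\in\{x_1,\dots,x_k\}$ for all $(x_1,\dots,x_k)\in\mathbb{N}^k$, and a non-self-loop function otherwise. $\langle B,S\rangle$ is an $\mathbb{N}$-Induction Model if every $G\subseteq\mathbb{N}$ with $B\subseteq G$ and such that $x_1,\dots,x_k\in G$, $S(x_1,\dots,x_k)\in\mathbb{N}$ imply $S(x_1,\dots,x_k)\in G$, satisfies $G=\mathbb{N}$. -}

module Defs where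

open import Data.Nat using (ℕ; _<_)
open import Data.Integer using (ℤ; +_)
open import Data.Fin using (Fin)
open import Data.Product using (∃-syntax)
open import Relation.Nullary using (¬_)
open import Relation.Binary.PropositionalEquality using (_≡_)

-- The paper's ℕ = {1,2,...} is represented by the positive elements
-- of Agda's ℕ (those n with 0 < n).

Tuple : ℕ → Set
Tuple k = Fin k → ℕ

PosTuple : {k : ℕ} → Tuple k → Set
PosTuple x = ∀ i → 0 < x i

SubsetOfℕ⁺ : (ℕ → Set) → Set
SubsetOfℕ⁺ A = ∀ n → A n → 0 < n

IsSelfLoop : {k : ℕ} → (Tuple k → ℤ) → Set
IsSelfLoop S = ∀ x → PosTuple x → ∃[ i ] (S x ≡ + (x i))

IsNonSelfLoop : {k : ℕ} → (Tuple k → ℤ) → Set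
IsNonSelfLoop S = ¬ IsSelfLoop S

IsInductionModel : {k : ℕ} → (ℕ → Set) → (Tuple k → ℤ) → Set₁
IsInductionModel B S =
  ∀ (G : ℕ → Set) →
    SubsetOfℕ⁺ G →
    (∀ n → B n → G n) →
    (∀ x → PosTuple x → (∀ i → G (x i)) →
       ∀ m → S x ≡ + m → 0 < m → G m) →
    ∀ n → 0 < n → G n

-- Take S(x, y) = x + 1 if x = y and x ∸ y otherwise.  S(1, 1) = 2 shows S is
-- not a self-loop.  A set G closed under S and containing some b ≥ 1 contains
-- S(b, b) = b + 1, hence S(b + 1, b) = 1, and from 1 it reaches every n ≥ 1
-- through S(n, n) = n + 1.
module Submission where

open import Defs
open import Data.Nat using (ℕ; zero; suc; _≤_; _<_; _∸_; _≟_; z<s; s≤s; z≤n)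
open import Data.Nat.Properties using (1+n≢n; m+n∸n≡m)
open import Data.Integer using (ℤ; +_)
open import Data.Fin using (zero; suc)
open import Data.Vec.Functional using ([]; _∷_)
open import Data.Product using (Σ; ∃-syntax; _×_; _,_)
open import Data.Empty using (⊥-elim)
open import Relation.Nullary using (yes; no)
open import Relation.Binary.PropositionalEquality using (_≡_; refl; cong)

successorOrDifference : Tuple 2 → ℤ
successorOrDifference x with x zero ≟ x (suc zero)
... | yes _ = + suc (x zero)
... | no  _ = + (x zero ∸ x (suc zero))

successorOrDifference-diagonal : ∀ a → successorOrDifference (a ∷ a ∷ []) ≡ + suc a
successorOrDifference-diagonal a with a ≟ a
... | yes _  = refl
... | no a≢a = ⊥-elim (a≢a refl)

successorOrDifference-suc : ∀ b → successorOrDifference (suc b ∷ b ∷ []) ≡ + 1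
successorOrDifference-suc b with suc b ≟ b
... | yes 1+b≡b = ⊥-elim (1+n≢n 1+b≡b)
... | no  _     = cong +_ (m+n∸n≡m 1 b)

successorOrDifference-nonSelfLoop : IsNonSelfLoop successorOrDifference
successorOrDifference-nonSelfLoop selfLoop
  with selfLoop (1 ∷ 1 ∷ []) (λ { zero → z<s ; (suc zero) → z<s })
... | zero     , ()
... | suc zero , ()

ClosedUnder : {k : ℕ} → (Tuple k → ℤ) → (ℕ → Set) → Set
ClosedUnder S G =
  ∀ x → PosTuple x → (∀ i → G (x i)) → ∀ m → S x ≡ + m → 0 < m → G m

module _ {G : ℕ → Set} (closed : ClosedUnder successorOrDifference G) where

  closed-pair : ∀ {a c m} → 0 < a → 0 < c → G a → G c →
                successorOrDifference (a ∷ c ∷ []) ≡ + m → 0 < m → G m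
  closed-pair {a} {c} 0<a 0<c Ga Gc =
    closed (a ∷ c ∷ []) (λ { zero → 0<a ; (suc zero) → 0<c })
                        (λ { zero → Ga  ; (suc zero) → Gc })
                        _

  closed-suc : ∀ {a} → 0 < a → G a → G (suc a)
  closed-suc {a} 0<a Ga = closed-pair 0<a 0<a Ga Ga (successorOrDifference-diagonal a) z<s

  closed-one : ∀ {b} → 0 < b → G b → G 1
  closed-one {b} 0<b Gb =
    closed-pair z<s 0<b (closed-suc 0<b Gb) Gb (successorOrDifference-suc b) z<s

  closed-positive : ∀ {b} → 0 < b → G b → ∀ n → 0 < n → G n
  closed-positive 0<b Gb (suc zero)    _ = closed-one 0<b Gb
  closed-positive 0<b Gb (suc (suc n)) _ = closed-suc z<s (closed-positive 0<b Gb (suc n) z<s)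

successorOrDifference-inductionModel : (B : ℕ → Set) → SubsetOfℕ⁺ B → ∃[ n ] B n →
                                       IsInductionModel B successorOrDifference
successorOrDifference-inductionModel B B⁺ (b , Bb) G _ B⊆G closed =
  closed-positive closed (B⁺ b Bb) (B⊆G b Bb)

lemma3 : (B : ℕ → Set) → SubsetOfℕ⁺ B → ∃[ n ] B n →
         ∃[ k ] (1 ≤ k × Σ (Tuple k → ℤ) (λ S → IsNonSelfLoop S × IsInductionModel B S))
lemma3 B B⁺ B≠∅ =
  2 , s≤s z≤n , successorOrDifference ,
  successorOrDifference-nonSelfLoop ,
  successorOrDifference-inductionModel B B⁺ B≠∅
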